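{- Let $I$ be a regular icosahedron in $\mathbb{R}^{3}$ centred at the origin, with vertex set $V$ and face set $F$. Let $[V]$ be the set of $6$ antipodal pairs of vertices and $[F]$ the set of $10$ antipodal pairs of faces, and let $\Pi_{I}$ be the undirected bipartite graph on $[V]\cup[F]$ in which $[v]\in[V]$ is adjacent to $[f]\in[F]$ if and only if some vertex in the class $[v]$ lies on some face in the class $[f]$. Choose a vertex $O$ of $I$ and let $A,B,C,D,E$ be the five vertices of $I$ adjacent to $O$ (along edges of $I$), listed in cyclic order around $O$, so that $AB$, $BC$, $CD$, $DE$, $EA$ are edges of $I$ (thus the subgraph of the $1$-skeleton of $I$ induced on $\{O,A,B,C,D,E\}$ is a $5$-wheel with hub $O$; these six vertices represent the six classes in $[V]$). Let $\Xi_{I}$ be the undirected graph obtained from $\Pi_{I}$ by adding the three edges $[A][C]$, $[B][O]$, $[D][E]$ between vertices of $[V]$. Then the automorphism group of $\Xi_{I}$ (a graph on $16$ vertices) is isomorphic to the alternating group $A_{4}$.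
   Context: For a point $x\in\mathbb{R}^3\setminus\{0\}$, $[x]$ denotes its projective class, i.e. here the antipodal pair $\{x,-x\}$; for a vertex or face of the centrally symmetric icosahedron $I$ this is the pair consisting of it and its antipode. -}

module Defs where

open import Data.Nat using (ℕ; zero; suc; _+_; _<ᵇ_)
open import Data.Nat.Divisibility using (_∣_)
open import Data.Fin using (Fin; #_; toℕ)
open import Data.Fin.Properties using (_≟_)
open import Data.Fin.Permutation using (Permutation′; _⟨$⟩ʳ_)
open import Data.Vec using (Vec; []; _∷_; lookup; allFin; toList)
open import Data.Vec.Membership.Propositional using (_∈_)
open import Data.List using (List; length; filter; concatMap; map)
open import Data.Bool using (Bool; true; false; _∧_; _∨_; not; if_then_else_)
open import Data.Product using (Σ; _×_; _,_)
open import Data.Sum using (_⊎_; inj₁; inj₂)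
open import Data.Empty using (⊥)
open import Relation.Nullary using (¬_; does)
open import Relation.Binary.PropositionalEquality using (_≡_; refl)
open import Function.Bundles using (_↔_; _⇔_; Inverse)
open import Function.Construct.Composition using (_↔-∘_)
import Function.Construct.Composition as Comp

-- Vertices (Fin 12):  0 = top pole,  1+k = u_k (upper ring, k = 0..4,
-- at longitude 72k),  6+k = l_k (lower ring, at longitude 72k+36),
-- 11 = bottom pole.  Upper ring lies above, lower ring below, the
-- equatorial plane; this is the standard embedding of the regular
-- icosahedron, and the antipodal map x ↦ -x sends
--   top ↔ bottom,  u_k ↦ l_{k+2},  l_k ↦ u_{k+3}   (indices mod 5).
--
-- Faces (Fin 20), as triples of vertices:
--   0+k  : T_k = (top, u_k, u_{k+1})
--   5+k  : M_k = (u_k, u_{k+1}, l_k)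
--   10+k : B_k = (bottom, l_k, l_{k+1})
--   15+k : N_k = (l_k, l_{k+1}, u_{k+1})

V : Set
V = Fin 12

F : Set
F = Fin 20

faceVerts : F → Vec V 3
faceVerts = lookup
  ( (# 0 ∷ # 1 ∷ # 2 ∷ []) ∷ (# 0 ∷ # 2 ∷ # 3 ∷ []) ∷ (# 0 ∷ # 3 ∷ # 4 ∷ [])
  ∷ (# 0 ∷ # 4 ∷ # 5 ∷ []) ∷ (# 0 ∷ # 5 ∷ # 1 ∷ [])
  ∷ (# 1 ∷ # 2 ∷ # 6 ∷ []) ∷ (# 2 ∷ # 3 ∷ # 7 ∷ []) ∷ (# 3 ∷ # 4 ∷ # 8 ∷ [])
  ∷ (# 4 ∷ # 5 ∷ # 9 ∷ []) ∷ (# 5 ∷ # 1 ∷ # 10 ∷ [])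
  ∷ (# 11 ∷ # 6 ∷ # 7 ∷ []) ∷ (# 11 ∷ # 7 ∷ # 8 ∷ []) ∷ (# 11 ∷ # 8 ∷ # 9 ∷ [])
  ∷ (# 11 ∷ # 9 ∷ # 10 ∷ []) ∷ (# 11 ∷ # 10 ∷ # 6 ∷ [])
  ∷ (# 6 ∷ # 7 ∷ # 2 ∷ []) ∷ (# 7 ∷ # 8 ∷ # 3 ∷ []) ∷ (# 8 ∷ # 9 ∷ # 4 ∷ [])
  ∷ (# 9 ∷ # 10 ∷ # 5 ∷ []) ∷ (# 10 ∷ # 6 ∷ # 1 ∷ [])
  ∷ [])

_onFace_ : V → F → Set
v onFace f = v ∈ faceVerts f

EdgeI : V → V → Set
EdgeI v w = ¬ (v ≡ w) × Σ F (λ f → (v onFace f) × (w onFace f))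

antiV : V → V
antiV = lookup (# 11 ∷ # 8 ∷ # 9 ∷ # 10 ∷ # 6 ∷ # 7 ∷ # 4 ∷ # 5 ∷ # 1 ∷ # 2 ∷ # 3 ∷ # 0 ∷ [])

antiF : F → F
antiF = lookup ( # 12 ∷ # 13 ∷ # 14 ∷ # 10 ∷ # 11
               ∷ # 17 ∷ # 18 ∷ # 19 ∷ # 15 ∷ # 16
               ∷ # 3 ∷ # 4 ∷ # 0 ∷ # 1 ∷ # 2
               ∷ # 8 ∷ # 9 ∷ # 5 ∷ # 6 ∷ # 7 ∷ [])

-- Projective classes.  [V] is identified with Fin 6 and [F] with Fin 10
-- via the class maps below; classV v = classV w  iff  w ∈ {v, -v}
-- (and likewise for faces) -- see the checked facts further down.

CV : Set
CV = Fin 6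

CF : Set
CF = Fin 10

classV : V → CV
classV = lookup (# 0 ∷ # 1 ∷ # 2 ∷ # 3 ∷ # 4 ∷ # 5 ∷ # 4 ∷ # 5 ∷ # 1 ∷ # 2 ∷ # 3 ∷ # 0 ∷ [])

classF : F → CF
classF = lookup ( # 0 ∷ # 1 ∷ # 2 ∷ # 3 ∷ # 4
                ∷ # 5 ∷ # 6 ∷ # 7 ∷ # 8 ∷ # 9
                ∷ # 3 ∷ # 4 ∷ # 0 ∷ # 1 ∷ # 2
                ∷ # 8 ∷ # 9 ∷ # 5 ∷ # 6 ∷ # 7 ∷ [])

private
  allB : ∀ {n} → (Fin n → Bool) → Bool
  allB {n} p = Data.List.foldr _∧_ true (map p (toList (allFin n)))
    where import Data.List

  _==_ : ∀ {n} → Fin n → Fin n → Bool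
  a == b = does (a ≟ b)

  memB : ∀ {n k} → Fin n → Vec (Fin n) k → Bool
  memB a [] = false
  memB a (b ∷ bs) = (a == b) ∨ memB a bs

  _⇔B_ : Bool → Bool → Bool
  a ⇔B b = (a ∧ b) ∨ (not a ∧ not b)

classV-correct : allB (λ v → allB (λ w →
                   (classV v == classV w) ⇔B ((w == v) ∨ (w == antiV v)))) ≡ true
classV-correct = refl

classF-correct : allB (λ f → allB (λ g →
                   (classF f == classF g) ⇔B ((g == f) ∨ (g == antiF f)))) ≡ true
classF-correct = refl

antiV-fpf : allB (λ v → not (antiV v == v) ∧ (antiV (antiV v) == v)) ≡ true
antiV-fpf = refl

antiF-correct : allB (λ f → allB (λ v →
                  memB v (faceVerts f) ⇔B memB (antiV v) (faceVerts (antiF f)))) ≡ true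
antiF-correct = refl

Node : Set
Node = CV ⊎ CF

AdjΠ : CV → CF → Set
AdjΠ cv cf = Σ V (λ v → Σ F (λ f → (classV v ≡ cv) × (classF f ≡ cf) × (v onFace f)))

ExtraEdge : V → V → CV → CV → Set
ExtraEdge P Q x y = ((x ≡ classV P) × (y ≡ classV Q)) ⊎ ((x ≡ classV Q) × (y ≡ classV P))

XiAdj : (O A B C D E : V) → Node → Node → Set
XiAdj O A B C D E (inj₁ x) (inj₂ y) = AdjΠ x y
XiAdj O A B C D E (inj₂ y) (inj₁ x) = AdjΠ x y
XiAdj O A B C D E (inj₂ _) (inj₂ _) = ⊥
XiAdj O A B C D E (inj₁ x) (inj₁ y) =
  ExtraEdge A C x y ⊎ ExtraEdge B O x y ⊎ ExtraEdge D E x y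

record Aut {N : Set} (R : N → N → Set) : Set where
  field
    perm      : N ↔ N
    preserves : ∀ x y → R x y ⇔ R (Inverse.to perm x) (Inverse.to perm y)

_≈Aut_ : ∀ {N} {R : N → N → Set} → Aut R → Aut R → Set
g ≈Aut h = ∀ x → Inverse.to (Aut.perm g) x ≡ Inverse.to (Aut.perm h) x

-- g ∘ h  (first h, then g)
_∘Aut_ : ∀ {N} {R : N → N → Set} → Aut R → Aut R → Aut R
_∘Aut_ {R = R} g h = record
  { perm      = Aut.perm g ↔-∘ Aut.perm h
  ; preserves = λ x y → Comp._⇔-∘_ (Aut.preserves g (Inverse.to (Aut.perm h) x)
                                                    (Inverse.to (Aut.perm h) y))
                                  (Aut.preserves h x y)
  }

inversions : ∀ {n} → Permutation′ n → ℕ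
inversions {n} σ = length (filter (λ p → isInv p) pairs)
  where
    open import Data.Product using (proj₁; proj₂)
    open import Data.Nat using (_<?_)
    open import Relation.Nullary.Decidable using (_×-dec_)
    pairs : List (Fin n × Fin n)
    pairs = concatMap (λ i → map (λ j → (i , j)) (toList (allFin n))) (toList (allFin n))
    isInv : (p : Fin n × Fin n) → _
    isInv (i , j) = (toℕ i <? toℕ j) ×-dec (toℕ (σ ⟨$⟩ʳ j) <? toℕ (σ ⟨$⟩ʳ i))

record Alt4 : Set where
  field
    perm : Permutation′ 4
    even : 2 ∣ inversions perm

_≈Alt_ : Alt4 → Alt4 → Set
s ≈Alt t = ∀ i → Alt4.perm s ⟨$⟩ʳ i ≡ Alt4.perm t ⟨$⟩ʳ i

IsoToA4 : ∀ {N} (R : N → N → Set) → Set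
IsoToA4 R =
  Σ (Aut R → Alt4) λ φ →
      (∀ g h i → Alt4.perm (φ (g ∘Aut h)) ⟨$⟩ʳ i
                 ≡ Alt4.perm (φ g) ⟨$⟩ʳ (Alt4.perm (φ h) ⟨$⟩ʳ i))
    × (∀ g h → φ g ≈Alt φ h → g ≈Aut h)
    × (∀ s → Σ (Aut R) λ g → φ g ≈Alt s)

-- The three added edges form a perfect matching of the six
-- vertex classes, and rotations of I act on Π_I.  Every wheel can be rotated
-- about the polar axis so that its matching becomes that of the wheel around
-- the top vertex, so all the graphs Ξ_I are isomorphic to one of them, Ξ.
-- The automorphisms of Ξ are the twelve words in a rotation a of order 3 and
-- a half-turn b fixing its matching; a backtracking search shows there are no
-- others.  They permute the four face classes that meet every added edge,
-- faithfully and by exactly the even permutations, which identifies Aut(Ξ)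
-- with A₄.

module Submission where

open import Defs
open import Data.Fin using (Fin; zero; suc; #_; toℕ; _↑ˡ_; remQuot)
open import Data.Fin.Permutation using (Permutation′; _⟨$⟩ʳ_; permutation)
open import Data.Fin.Properties using (_≟_; all?; any?)
open import Data.List using (List; []; _∷_; length; filter; concatMap; map)
open import Data.List.Membership.Propositional using () renaming (_∈_ to _∈ˡ_)
import Data.List.Membership.DecPropositional as ListMembership
open import Data.List.Properties using (filter-≐)
open import Data.List.Relation.Unary.All as All using (All; []; _∷_)
open import Data.Nat using (ℕ; zero; suc; _<_; _<?_; _∸_)
open import Data.Nat.Divisibility using (_∣_; _∣?_)
open import Data.Empty using (⊥-elim)
open import Data.Product using (Σ; Σ-syntax; ∃-syntax; _×_; _,_; proj₁; uncurry)
open import Data.Sum using (inj₁; inj₂)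
import Data.Sum as Sum
open import Data.Sum.Properties using (≡-dec)
open import Data.Vec using (Vec; []; _∷_; lookup; tabulate; allFin; toList)
open import Data.Vec.Properties using (lookup∘tabulate)
open import Data.Vec.Relation.Unary.Any using (Any; here; there)
import Data.Vec.Relation.Unary.All as VecAll
open import Data.Vec.Membership.Propositional using (_∈_; find)
import Data.Vec.Relation.Unary.Any as VecAny
open import Function using (id; _∘_)
open import Function.Bundles using (_↔_; _⇔_; Inverse; Injection; Equivalence; mk⇔; mk↔ₛ′)
open import Function.Properties.Inverse using (↔⇒↣)
open import Function.Construct.Composition using (_↔-∘_; _⇔-∘_)
open import Function.Construct.Identity using (↔-id; ⇔-id)
open import Function.Construct.Symmetry using (↔-sym; ⇔-sym)
open import Relation.Binary.PropositionalEquality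
  using (_≡_; refl; sym; trans; cong; subst; subst₂; module ≡-Reasoning)
open import Relation.Nullary using (Dec; yes; no; ¬?)
open import Relation.Nullary.Decidable using (from-yes; map′; _×-dec_; _⊎-dec_; _→-dec_)
import Relation.Nullary.Decidable as Dec

_⇔?_ : {A B : Set} → Dec A → Dec B → Dec (A ⇔ B)
yes a ⇔? yes b = yes (mk⇔ (λ _ → b) (λ _ → a))
yes a ⇔? no ¬b = no λ a⇔b → ¬b (Equivalence.to a⇔b a)
no ¬a ⇔? yes b = no λ a⇔b → ¬a (Equivalence.from a⇔b b)
no ¬a ⇔? no ¬b = yes (mk⇔ (⊥-elim ∘ ¬a) (⊥-elim ∘ ¬b))

_∈?_ : ∀ {n k} (x : Fin n) (xs : Vec (Fin n) k) → Dec (x ∈ xs)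
x ∈? xs = VecAny.any? (x ≟_) xs

∀∈? : {A : Set} {P : A → Set} {n : ℕ} (xs : Vec A n) → (∀ x → Dec (P x)) → Dec (∀ x → x ∈ xs → P x)
∀∈? xs P? = map′ (λ all _ → VecAll.lookup all) (fromMembership xs) (VecAll.all? P? xs)
  where
    fromMembership : ∀ {n} (xs : Vec _ n) → (∀ x → x ∈ xs → _) → VecAll.All _ xs
    fromMembership []       _ = VecAll.[]
    fromMembership (x ∷ xs) h = h x (here refl) VecAll.∷ fromMembership xs (λ y → h y ∘ there)

_≟ᴺ_ : (x y : Node) → Dec (x ≡ y)
_≟ᴺ_ = ≡-dec _≟_ _≟_

∀-Node? : {P : Node → Set} → (∀ x → Dec (P x)) → Dec (∀ x → P x)
∀-Node? P? = map′ (uncurry Sum.[_,_]) (λ h → h ∘ inj₁ , h ∘ inj₂)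
                  (all? (P? ∘ inj₁) ×-dec all? (P? ∘ inj₂))

module _ {N : Set} where

  record _≅_ (R S : N → N → Set) : Set where
    field
      bijection : N ↔ N
      preserves : ∀ x y → R x y ⇔ S (Inverse.to bijection x) (Inverse.to bijection y)

  open _≅_

  ⟦_⟧ : {R : N → N → Set} → Aut R → N → N
  ⟦ g ⟧ = Inverse.to (Aut.perm g)

  isomorphism : {R : N → N → Set} → Aut R → R ≅ R
  isomorphism g = record { bijection = Aut.perm g ; preserves = Aut.preserves g }

  automorphism : {R : N → N → Set} → R ≅ R → Aut R
  automorphism σ = record { perm = bijection σ ; preserves = preserves σ }

  ≅-sym : {R S : N → N → Set} → R ≅ S → S ≅ R
  ≅-sym {R} {S} σ = record
    { bijection = ↔-sym (bijection σ)
    ; preserves = λ x y → subst₂ (λ u v → S u v ⇔ R (from x) (from y))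
                                 (strictlyInverseˡ x) (strictlyInverseˡ y)
                                 (⇔-sym (preserves σ (from x) (from y)))
    }
    where open Inverse (bijection σ)

  _∘≅_ : {R S T : N → N → Set} → S ≅ T → R ≅ S → R ≅ T
  τ ∘≅ σ = record
    { bijection = bijection τ ↔-∘ bijection σ
    ; preserves = λ x y → preserves τ _ _ ⇔-∘ preserves σ x y
    }

  identityᴬ : {R : N → N → Set} → Aut R
  identityᴬ = record { perm = ↔-id N ; preserves = λ _ _ → ⇔-id _ }

  _⁻¹ : {R : N → N → Set} → Aut R → Aut R
  g ⁻¹ = automorphism (≅-sym (isomorphism g))

  conjugate : {R S : N → N → Set} → R ≅ S → Aut R → Aut S
  conjugate σ g = automorphism (σ ∘≅ (isomorphism g ∘≅ ≅-sym σ))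

-- IsoToA4 asks nothing about how φ treats extensionally equal
-- automorphisms, and without that it cannot be transported.
IsoToA4ᵉ : {N : Set} (R : N → N → Set) → Set
IsoToA4ᵉ R = Σ (IsoToA4 R) λ iso → ∀ g h → g ≈Aut h → proj₁ iso g ≈Alt proj₁ iso h

module _ {N : Set} {R S : N → N → Set} (σ : R ≅ S) where

  private
    open _≅_ σ using (bijection)
    open Inverse bijection

    conjugate-∘ : ∀ g h → conjugate σ (g ∘Aut h) ≈Aut (conjugate σ g ∘Aut conjugate σ h)
    conjugate-∘ g h x = cong (to ∘ ⟦ g ⟧) (sym (strictlyInverseʳ (⟦ h ⟧ (from x))))

    conjugate-cong : ∀ g h → g ≈Aut h → conjugate σ g ≈Aut conjugate σ h
    conjugate-cong g h g≈h x = cong to (g≈h (from x))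

    conjugate-injective : ∀ g h → conjugate σ g ≈Aut conjugate σ h → g ≈Aut h
    conjugate-injective g h e x =
      subst (λ y → ⟦ g ⟧ y ≡ ⟦ h ⟧ y) (strictlyInverseʳ x) (Injection.injective (↔⇒↣ bijection) (e (to x)))

    conjugate-section : ∀ g → conjugate σ (conjugate (≅-sym σ) g) ≈Aut g
    conjugate-section g x =
      trans (strictlyInverseˡ (⟦ g ⟧ (to (from x)))) (cong ⟦ g ⟧ (strictlyInverseˡ x))

  transport : IsoToA4ᵉ S → IsoToA4ᵉ R
  transport ((φ , hom , inj , surj) , ext) =
    (φ ∘ conjugate σ , hom′ , inj′ , surj′) , λ g h e → ext _ _ (conjugate-cong g h e)
    where
      hom′ : ∀ g h i → Alt4.perm (φ (conjugate σ (g ∘Aut h))) ⟨$⟩ʳ i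
                     ≡ Alt4.perm (φ (conjugate σ g)) ⟨$⟩ʳ (Alt4.perm (φ (conjugate σ h)) ⟨$⟩ʳ i)
      hom′ g h i = trans (ext _ _ (conjugate-∘ g h) i) (hom _ _ i)

      inj′ : ∀ g h → φ (conjugate σ g) ≈Alt φ (conjugate σ h) → g ≈Aut h
      inj′ g h e = conjugate-injective g h (inj _ _ e)

      surj′ : ∀ s → Σ (Aut R) λ g → φ (conjugate σ g) ≈Alt s
      surj′ s with surj s
      ... | g , φg≈s = conjugate (≅-sym σ) g , λ i → trans (ext _ _ (conjugate-section g) i) (φg≈s i)

orderedPairs : ∀ n → List (Fin n × Fin n)
orderedPairs n = concatMap (λ i → map (λ j → (i , j)) (toList (allFin n))) (toList (allFin n))

Inversion : ∀ {n} → (Fin n → Fin n) → Fin n × Fin n → Set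
Inversion f (i , j) = toℕ i < toℕ j × toℕ (f j) < toℕ (f i)

inversion? : ∀ {n} (f : Fin n → Fin n) p → Dec (Inversion f p)
inversion? f (i , j) = (toℕ i <? toℕ j) ×-dec (toℕ (f j) <? toℕ (f i))

inversionCount : ∀ {n} → (Fin n → Fin n) → ℕ
inversionCount {n} f = length (filter (inversion? f) (orderedPairs n))

inversions≡inversionCount : ∀ {n} (σ : Permutation′ n) → inversions σ ≡ inversionCount (σ ⟨$⟩ʳ_)
inversions≡inversionCount σ = refl

inversionCount-cong : ∀ {n} {f g : Fin n → Fin n} → (∀ k → f k ≡ g k) →
                      inversionCount f ≡ inversionCount g
inversionCount-cong {n} {f} {g} f≗g =
  cong length (filter-≐ (inversion? f) (inversion? g) (along f≗g , along (sym ∘ f≗g)) (orderedPairs n))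
  where
    along : ∀ {f g} → (∀ k → f k ≡ g k) → ∀ {p} → Inversion f p → Inversion g p
    along f≗g {i , j} (i<j , fj<fi) = i<j , subst₂ (λ a b → toℕ a < toℕ b) (f≗g j) (f≗g i) fj<fi

tuple-injective : ∀ {n} (σ : Permutation′ n) i j →
                  lookup (tabulate (σ ⟨$⟩ʳ_)) i ≡ lookup (tabulate (σ ⟨$⟩ʳ_)) j → i ≡ j
tuple-injective σ i j e = Injection.injective (↔⇒↣ σ)
  (trans (sym (lookup∘tabulate (σ ⟨$⟩ʳ_) i)) (trans e (lookup∘tabulate (σ ⟨$⟩ʳ_) j)))

tuple-even : (s : Alt4) → 2 ∣ inversionCount (lookup (tabulate (Alt4.perm s ⟨$⟩ʳ_)))
tuple-even s = subst (2 ∣_)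
  (trans (inversions≡inversionCount σ) (inversionCount-cong (sym ∘ lookup∘tabulate (σ ⟨$⟩ʳ_))))
  (Alt4.even s)
  where σ = Alt4.perm s

-- Restriction of automorphisms to an invariant set of nodes

module CornerRestriction {N : Set} {R : N → N → Set} {n : ℕ}
  (corner : Fin n → N) (label : N → Fin n) (label-corner : ∀ k → label (corner k) ≡ k) where

  onCorners : Aut R → Fin n → Fin n
  onCorners g k = label (⟦ g ⟧ (corner k))

  KeepsCorners : Aut R → Set
  KeepsCorners g = ∀ k → corner (onCorners g k) ≡ ⟦ g ⟧ (corner k)

  onCorners-∘ : ∀ g h → KeepsCorners h → ∀ k → onCorners (g ∘Aut h) k ≡ onCorners g (onCorners h k)
  onCorners-∘ g h keeps k = cong (label ∘ ⟦ g ⟧) (sym (keeps k))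

  onCorners-inverse : ∀ g h → (∀ x → ⟦ g ⟧ (⟦ h ⟧ x) ≡ x) → KeepsCorners h →
                      ∀ k → onCorners g (onCorners h k) ≡ k
  onCorners-inverse g h g∘h≗id keeps k = begin
    label (⟦ g ⟧ (corner (label (⟦ h ⟧ (corner k))))) ≡⟨ cong (label ∘ ⟦ g ⟧) (keeps k) ⟩
    label (⟦ g ⟧ (⟦ h ⟧ (corner k)))                   ≡⟨ cong label (g∘h≗id (corner k)) ⟩
    label (corner k)                                     ≡⟨ label-corner k ⟩
    k                                                    ∎
    where open ≡-Reasoning

  restrict : (g : Aut R) → KeepsCorners g → KeepsCorners (g ⁻¹) → Permutation′ n
  restrict g keeps keeps⁻¹ = permutation (onCorners g) (onCorners (g ⁻¹))
    (onCorners-inverse g (g ⁻¹) (Inverse.strictlyInverseˡ (Aut.perm g)) keeps⁻¹)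
    (onCorners-inverse (g ⁻¹) g (Inverse.strictlyInverseʳ (Aut.perm g)) keeps)

-- Completeness of a list of automorphisms by backtracking search

module AutomorphismSearch {N : Set} (_≟ₙ_ : (x y : N) → Dec (x ≡ y))
  (nodes : List N) (nodes-complete : ∀ x → x ∈ˡ nodes)
  (R : N → N → Set) (R? : ∀ x y → Dec (R x y)) {m : ℕ} (candidate : Fin m → N → N) where

  Assignment : Set
  Assignment = List (N × N)

  Consistent : Assignment → N → N → Set
  Consistent σ x y = All (λ (u , v) → (R x u ⇔ R y v) × (x ≡ u ⇔ y ≡ v)) σ

  Extends : Fin m → Assignment → Set
  Extends i σ = All (λ (u , v) → candidate i u ≡ v) σ

  -- However the nodes xs are mapped consistently with σ, the result agrees with some candidate.
  Certificate : Assignment → List N → Set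
  Certificate σ []       = ∃[ i ] Extends i σ
  Certificate σ (x ∷ xs) = All (λ y → Consistent σ x y → Certificate ((x , y) ∷ σ) xs) nodes

  certificate? : ∀ σ xs → Dec (Certificate σ xs)
  certificate? σ []       = any? λ i → All.all? (λ (u , v) → candidate i u ≟ₙ v) σ
  certificate? σ (x ∷ xs) = All.all? (λ y → consistent? y →-dec certificate? ((x , y) ∷ σ) xs) nodes
    where
      consistent? : ∀ y → Dec (Consistent σ x y)
      consistent? y = All.all? (λ (u , v) → (R? x u ⇔? R? y v) ×-dec ((x ≟ₙ u) ⇔? (y ≟ₙ v))) σ

  module _ (f : N → N) (injective : ∀ x y → f x ≡ f y → x ≡ y)
           (preserves : ∀ x y → R x y ⇔ R (f x) (f y)) where

    consistent : ∀ σ x → All (λ (u , v) → f u ≡ v) σ → Consistent σ x (f x)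
    consistent []            x []           = []
    consistent ((u , _) ∷ σ) x (refl ∷ f∘σ) =
      (preserves x u , mk⇔ (cong f) (injective x u)) ∷ consistent σ x f∘σ

    sound : ∀ σ xs → All (λ (u , v) → f u ≡ v) σ → Certificate σ xs →
            ∃[ i ] Extends i σ × All (λ x → f x ≡ candidate i x) xs
    sound σ []       f∘σ (i , ext) = i , ext , []
    sound σ (x ∷ xs) f∘σ cert
      with sound ((x , f x) ∷ σ) xs (refl ∷ f∘σ)
                 (All.lookup cert (nodes-complete (f x)) (consistent σ x f∘σ))
    ... | i , fx≡ ∷ ext , rest = i , ext , sym fx≡ ∷ rest

  complete : Certificate [] nodes → (g : Aut R) → ∃[ i ] (∀ x → ⟦ g ⟧ x ≡ candidate i x)
  complete cert g
    with sound ⟦ g ⟧ (λ _ _ → Injection.injective (↔⇒↣ (Aut.perm g))) (Aut.preserves g) [] nodes [] cert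
  ... | i , _ , agree = i , λ x → All.lookup agree (nodes-complete x)

-- Faces 0–9 lie in distinct classes; faces 10–19 are their antipodes.
representative : CF → F
representative f = f ↑ˡ 10

classF-representative : ∀ f → classF (representative f) ≡ f
classF-representative = from-yes (all? λ f → classF (representative f) ≟ f)

onFace-representative : ∀ g v → v onFace g →
                        Any (λ w → classV w ≡ classV v) (faceVerts (representative (classF g)))
onFace-representative = from-yes (all? λ g → all? λ v →
  (v ∈? faceVerts g) →-dec
  VecAny.any? (λ w → classV w ≟ classV v) (faceVerts (representative (classF g))))

AdjΠ⇔representative : ∀ x f → AdjΠ x f ⇔ Any (λ v → classV v ≡ x) (faceVerts (representative f))
AdjΠ⇔representative x f = mk⇔
  (λ { (v , g , refl , refl , v∈g) → onFace-representative g v v∈g })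
  (λ meets → let v , v∈f , [v]≡x = find meets in
             v , representative f , [v]≡x , classF-representative f , v∈f)

AdjΠ? : ∀ x f → Dec (AdjΠ x f)
AdjΠ? x f = Dec.map (⇔-sym (AdjΠ⇔representative x f))
                    (VecAny.any? (λ v → classV v ≟ x) (faceVerts (representative f)))

ExtraEdge? : ∀ P Q x y → Dec (ExtraEdge P Q x y)
ExtraEdge? P Q x y = ((x ≟ classV P) ×-dec (y ≟ classV Q)) ⊎-dec ((x ≟ classV Q) ×-dec (y ≟ classV P))

XiAdj? : ∀ O A B C D E x y → Dec (XiAdj O A B C D E x y)
XiAdj? O A B C D E (inj₁ x) (inj₁ y) = ExtraEdge? A C x y ⊎-dec ExtraEdge? B O x y ⊎-dec ExtraEdge? D E x y
XiAdj? O A B C D E (inj₁ x) (inj₂ f) = AdjΠ? x f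
XiAdj? O A B C D E (inj₂ f) (inj₁ x) = AdjΠ? x f
XiAdj? O A B C D E (inj₂ _) (inj₂ _) = no λ ()

neighbours : V → Vec V 5
neighbours = lookup
  ( (# 1 ∷ # 2 ∷ # 3 ∷ # 4 ∷ # 5 ∷ []) ∷ (# 0 ∷ # 2 ∷ # 5 ∷ # 6 ∷ # 10 ∷ [])
  ∷ (# 0 ∷ # 1 ∷ # 3 ∷ # 6 ∷ # 7 ∷ []) ∷ (# 0 ∷ # 2 ∷ # 4 ∷ # 7 ∷ # 8 ∷ [])
  ∷ (# 0 ∷ # 3 ∷ # 5 ∷ # 8 ∷ # 9 ∷ []) ∷ (# 0 ∷ # 1 ∷ # 4 ∷ # 9 ∷ # 10 ∷ [])
  ∷ (# 1 ∷ # 2 ∷ # 7 ∷ # 10 ∷ # 11 ∷ []) ∷ (# 2 ∷ # 3 ∷ # 6 ∷ # 8 ∷ # 11 ∷ [])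
  ∷ (# 3 ∷ # 4 ∷ # 7 ∷ # 9 ∷ # 11 ∷ []) ∷ (# 4 ∷ # 5 ∷ # 8 ∷ # 10 ∷ # 11 ∷ [])
  ∷ (# 1 ∷ # 5 ∷ # 6 ∷ # 9 ∷ # 11 ∷ []) ∷ (# 6 ∷ # 7 ∷ # 8 ∷ # 9 ∷ # 10 ∷ [])
  ∷ [])

EdgeI⇔neighbour : ∀ v w → EdgeI v w ⇔ w ∈ neighbours v
EdgeI⇔neighbour = from-yes (all? λ v → all? λ w → EdgeI? v w ⇔? (w ∈? neighbours v))
  where
    EdgeI? : ∀ v w → Dec (EdgeI v w)
    EdgeI? v w = ¬? (v ≟ w) ×-dec any? λ f → (v ∈? faceVerts f) ×-dec (w ∈? faceVerts f)

-- Rotating an arbitrary wheel to the one around the top vertex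

_^_ : {A : Set} → (A → A) → ℕ → A → A
f ^ zero  = id
f ^ suc k = f ∘ f ^ k

-- The rotation of I by 72° about the polar axis, u_k ↦ u_{k+1}, l_k ↦ l_{k+1}.
rotateV : CV → CV
rotateV = lookup (# 0 ∷ # 2 ∷ # 3 ∷ # 4 ∷ # 5 ∷ # 1 ∷ [])

rotateF : CF → CF
rotateF = lookup (# 1 ∷ # 2 ∷ # 3 ∷ # 4 ∷ # 0 ∷ # 6 ∷ # 7 ∷ # 8 ∷ # 9 ∷ # 5 ∷ [])

rotate : ℕ → Node → Node
rotate k = Sum.map (rotateV ^ k) (rotateF ^ k)

rotation-AdjΠ : ∀ x f → AdjΠ x f ⇔ AdjΠ (rotateV x) (rotateF f)
rotation-AdjΠ = from-yes (all? λ x → all? λ f → AdjΠ? x f ⇔? AdjΠ? (rotateV x) (rotateF f))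

rotate-AdjΠ : ∀ k x f → AdjΠ x f ⇔ AdjΠ ((rotateV ^ k) x) ((rotateF ^ k) f)
rotate-AdjΠ zero    x f = ⇔-id _
rotate-AdjΠ (suc k) x f = rotation-AdjΠ _ _ ⇔-∘ rotate-AdjΠ k x f

rotate-inverseˡ : ∀ (k : Fin 5) x → rotate (toℕ k) (rotate (5 ∸ toℕ k) x) ≡ x
rotate-inverseˡ = from-yes (all? λ (k : Fin 5) → ∀-Node? λ x → rotate (toℕ k) (rotate (5 ∸ toℕ k) x) ≟ᴺ x)

rotate-inverseʳ : ∀ (k : Fin 5) x → rotate (5 ∸ toℕ k) (rotate (toℕ k) x) ≡ x
rotate-inverseʳ = from-yes (all? λ (k : Fin 5) → ∀-Node? λ x → rotate (5 ∸ toℕ k) (rotate (toℕ k) x) ≟ᴺ x)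

-- Ξ_I for the wheel O = top, A, …, E = u₀, …, u₄.
Ξ : Node → Node → Set
Ξ = XiAdj (# 0) (# 1) (# 2) (# 3) (# 4) (# 5)

rotate-≅ : ∀ {O A B C D E} (k : Fin 5) →
           (∀ x y → XiAdj O A B C D E (inj₁ x) (inj₁ y) ⇔ Ξ (rotate (toℕ k) (inj₁ x)) (rotate (toℕ k) (inj₁ y))) →
           XiAdj O A B C D E ≅ Ξ
rotate-≅ {O} {A} {B} {C} {D} {E} k added = record
  { bijection = mk↔ₛ′ (rotate (toℕ k)) (rotate (5 ∸ toℕ k)) (rotate-inverseˡ k) (rotate-inverseʳ k)
  ; preserves = preserves
  }
  where
    preserves : ∀ x y → XiAdj O A B C D E x y ⇔ Ξ (rotate (toℕ k) x) (rotate (toℕ k) y)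
    preserves (inj₁ x) (inj₁ y) = added x y
    preserves (inj₁ x) (inj₂ f) = rotate-AdjΠ (toℕ k) x f
    preserves (inj₂ f) (inj₁ x) = rotate-AdjΠ (toℕ k) x f
    preserves (inj₂ _) (inj₂ _) = ⇔-id _

-- Facts established by evaluation are kept opaque: a with on them would
-- otherwise re-run that evaluation.
opaque
  wheel-rotation : ∀ O A → A ∈ neighbours O → ∀ B → B ∈ neighbours O → B ∈ neighbours A →
                   ∀ C → C ∈ neighbours O → C ∈ neighbours B → ∀ D → D ∈ neighbours O → D ∈ neighbours C →
                   ∀ E → E ∈ neighbours O → E ∈ neighbours D → A ∈ neighbours E →
                   Σ[ k ∈ Fin 5 ] ∀ x y → XiAdj O A B C D E (inj₁ x) (inj₁ y)
                                ⇔ Ξ (rotate (toℕ k) (inj₁ x)) (rotate (toℕ k) (inj₁ y))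
  wheel-rotation = from-yes
    (all? λ O → ∀∈? (neighbours O) λ A →
     ∀∈? (neighbours O) λ B → B ∈? neighbours A →-dec
     ∀∈? (neighbours O) λ C → C ∈? neighbours B →-dec
     ∀∈? (neighbours O) λ D → D ∈? neighbours C →-dec
     ∀∈? (neighbours O) λ E → E ∈? neighbours D →-dec A ∈? neighbours E →-dec
     any? λ (k : Fin 5) → all? λ x → all? λ y →
       XiAdj? O A B C D E (inj₁ x) (inj₁ y) ⇔? XiAdj? (# 0) (# 1) (# 2) (# 3) (# 4) (# 5)
                                                  (rotate (toℕ k) (inj₁ x)) (rotate (toℕ k) (inj₁ y)))

-- The automorphism group of Ξ

Ξ? : ∀ x y → Dec (Ξ x y)
Ξ? = XiAdj? (# 0) (# 1) (# 2) (# 3) (# 4) (# 5)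

-- Rotations of I of order 3 and 2 that permute the added edges [1][3], [2][0], [4][5].
aNode bNode : Node → Node
aNode = Sum.map (lookup (# 1 ∷ # 4 ∷ # 3 ∷ # 5 ∷ # 0 ∷ # 2 ∷ []))
                (lookup (# 7 ∷ # 9 ∷ # 4 ∷ # 0 ∷ # 5 ∷ # 2 ∷ # 6 ∷ # 3 ∷ # 1 ∷ # 8 ∷ []))
bNode = Sum.map (lookup (# 0 ∷ # 3 ∷ # 2 ∷ # 1 ∷ # 5 ∷ # 4 ∷ []))
                (lookup (# 1 ∷ # 0 ∷ # 4 ∷ # 3 ∷ # 2 ∷ # 6 ∷ # 5 ∷ # 9 ∷ # 8 ∷ # 7 ∷ []))

aNode³ : ∀ x → aNode (aNode (aNode x)) ≡ x
aNode³ = from-yes (∀-Node? λ x → aNode (aNode (aNode x)) ≟ᴺ x)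

bNode² : ∀ x → bNode (bNode x) ≡ x
bNode² = from-yes (∀-Node? λ x → bNode (bNode x) ≟ᴺ x)

aNode-Ξ : ∀ x y → Ξ x y ⇔ Ξ (aNode x) (aNode y)
aNode-Ξ = from-yes (∀-Node? λ x → ∀-Node? λ y → Ξ? x y ⇔? Ξ? (aNode x) (aNode y))

bNode-Ξ : ∀ x y → Ξ x y ⇔ Ξ (bNode x) (bNode y)
bNode-Ξ = from-yes (∀-Node? λ x → ∀-Node? λ y → Ξ? x y ⇔? Ξ? (bNode x) (bNode y))

a b : Aut Ξ
a = record { perm = mk↔ₛ′ aNode (aNode ∘ aNode) aNode³ aNode³ ; preserves = aNode-Ξ }
b = record { perm = mk↔ₛ′ bNode bNode bNode² bNode² ; preserves = bNode-Ξ }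

a^ : Fin 3 → Aut Ξ
a^ zero             = identityᴬ
a^ (suc zero)       = a
a^ (suc (suc zero)) = a ∘Aut a

-- A₄ = ⟨a⟩ ∪ ⟨a⟩ b ⟨a⟩.
candidate : Fin 12 → Aut Ξ
candidate i with remQuot {4} 3 i
... | zero  , n = a^ n
... | suc m , n = (a^ m ∘Aut b) ∘Aut a^ n

-- Each node is adjacent to an earlier one, which keeps the search small.
searchOrder : List Node
searchOrder = inj₁ (# 0) ∷ inj₁ (# 2) ∷ inj₂ (# 0) ∷ inj₂ (# 1) ∷ inj₁ (# 1) ∷ inj₁ (# 3)
            ∷ inj₂ (# 2) ∷ inj₂ (# 4) ∷ inj₂ (# 5) ∷ inj₁ (# 4) ∷ inj₂ (# 7) ∷ inj₁ (# 5)
            ∷ inj₂ (# 3) ∷ inj₂ (# 6) ∷ inj₂ (# 8) ∷ inj₂ (# 9) ∷ []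

searchOrder-complete : ∀ x → x ∈ˡ searchOrder
searchOrder-complete = from-yes (∀-Node? λ x → x ∈ˡ? searchOrder)
  where open ListMembership _≟ᴺ_ using () renaming (_∈?_ to _∈ˡ?_)

module Search = AutomorphismSearch _≟ᴺ_ searchOrder searchOrder-complete Ξ Ξ? (⟦_⟧ ∘ candidate)

opaque
  candidates-complete : (g : Aut Ξ) → ∃[ i ] (∀ x → ⟦ g ⟧ x ≡ ⟦ candidate i ⟧ x)
  candidates-complete = Search.complete (from-yes (Search.certificate? [] searchOrder))

-- The face classes [0 3 4], [0 1 5], [1 2 4], [2 3 5]: those meeting every added edge.
corner : Fin 4 → Node
corner = inj₂ ∘ lookup (# 2 ∷ # 4 ∷ # 5 ∷ # 6 ∷ [])

label : Node → Fin 4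
label (inj₁ _) = zero
label (inj₂ f) = lookup (# 0 ∷ # 0 ∷ # 0 ∷ # 0 ∷ # 1 ∷ # 2 ∷ # 3 ∷ # 0 ∷ # 0 ∷ # 0 ∷ []) f

label-corner : ∀ k → label (corner k) ≡ k
label-corner = from-yes (all? λ k → label (corner k) ≟ k)

open CornerRestriction {R = Ξ} corner label label-corner

opaque
  candidate-keepsCorners : ∀ i → KeepsCorners (candidate i)
  candidate-keepsCorners = from-yes (all? λ i → all? λ k →
    corner (onCorners (candidate i) k) ≟ᴺ ⟦ candidate i ⟧ (corner k))

  candidate-faithful : ∀ i j → (∀ k → onCorners (candidate i) k ≡ onCorners (candidate j) k) →
                       ∀ x → ⟦ candidate i ⟧ x ≡ ⟦ candidate j ⟧ x
  candidate-faithful = from-yes (all? λ i → all? λ j →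
    (all? λ k → onCorners (candidate i) k ≟ onCorners (candidate j) k) →-dec
    ∀-Node? λ x → ⟦ candidate i ⟧ x ≟ᴺ ⟦ candidate j ⟧ x)

  candidate-even : ∀ i → 2 ∣ inversionCount (onCorners (candidate i))
  candidate-even = from-yes (all? λ i → 2 ∣? inversionCount (onCorners (candidate i)))

  candidates-cover : ∀ p q r s → let t = lookup (p ∷ q ∷ r ∷ s ∷ []) in
                     (∀ i j → t i ≡ t j → i ≡ j) → 2 ∣ inversionCount t →
                     ∃[ c ] ∀ k → onCorners (candidate c) k ≡ t k
  candidates-cover = from-yes (all? λ p → all? λ q → all? λ r → all? λ s →
    let t = lookup (p ∷ q ∷ r ∷ s ∷ []) in
    (all? λ i → all? λ j → (t i ≟ t j) →-dec (i ≟ j)) →-dec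
    (2 ∣? inversionCount t) →-dec
    any? λ c → all? λ k → onCorners (candidate c) k ≟ t k)

keepsCorners : ∀ g → KeepsCorners g
keepsCorners g k with candidates-complete g
... | i , g≗i = begin
  corner (label (⟦ g ⟧ (corner k)))  ≡⟨ cong (corner ∘ label) (g≗i (corner k)) ⟩
  corner (onCorners (candidate i) k) ≡⟨ candidate-keepsCorners i k ⟩
  ⟦ candidate i ⟧ (corner k)         ≡⟨ sym (g≗i (corner k)) ⟩
  ⟦ g ⟧ (corner k)                   ∎
  where open ≡-Reasoning

onCorners-even : ∀ g → 2 ∣ inversionCount (onCorners g)
onCorners-even g with candidates-complete g
... | i , g≗i = subst (2 ∣_) (inversionCount-cong (λ k → cong label (sym (g≗i (corner k)))))
                      (candidate-even i)

onCorners-faithful : ∀ g h → (∀ k → onCorners g k ≡ onCorners h k) → g ≈Aut h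
onCorners-faithful g h g≐h x with candidates-complete g | candidates-complete h
... | i , g≗i | j , h≗j =
  trans (g≗i x) (trans (candidate-faithful i j i≐j x) (sym (h≗j x)))
  where
    i≐j : ∀ k → onCorners (candidate i) k ≡ onCorners (candidate j) k
    i≐j k = trans (cong label (sym (g≗i (corner k))))
                  (trans (g≐h k) (cong label (h≗j (corner k))))

onCorners-onto : (s : Alt4) → ∃[ c ] ∀ k → onCorners (candidate c) k ≡ Alt4.perm s ⟨$⟩ʳ k
onCorners-onto s
  with candidates-cover (v (# 0)) (v (# 1)) (v (# 2)) (v (# 3)) (tuple-injective σ) (tuple-even s)
  where σ = Alt4.perm s
        v = σ ⟨$⟩ʳ_
... | c , c≗t = c , λ k → trans (c≗t k) (lookup∘tabulate (Alt4.perm s ⟨$⟩ʳ_) k)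

Aut[Ξ]≅A₄ : IsoToA4ᵉ Ξ
Aut[Ξ]≅A₄ = (φ , (λ g h → onCorners-∘ g h (keepsCorners h)) , onCorners-faithful , onto)
          , λ g h g≈h k → cong label (g≈h (corner k))
  where
    φ : Aut Ξ → Alt4
    φ g = record { perm = restrict g (keepsCorners g) (keepsCorners (g ⁻¹)) ; even = onCorners-even g }

    onto : ∀ s → Σ (Aut Ξ) λ g → φ g ≈Alt s
    onto s with onCorners-onto s
    ... | c , c≗s = candidate c , c≗s

proposition2p5 : (O A B C D E : V)
    → EdgeI O A → EdgeI O B → EdgeI O C → EdgeI O D → EdgeI O E
    → EdgeI A B → EdgeI B C → EdgeI C D → EdgeI D E → EdgeI E A
    → IsoToA4 (XiAdj O A B C D E)
proposition2p5 O A B C D E oa ob oc od oe ab bc cd de ea =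
  let k , added = wheel-rotation O A (nb oa) B (nb ob) (nb ab) C (nb oc) (nb bc)
                                 D (nb od) (nb cd) E (nb oe) (nb de) (nb ea)
  in proj₁ (transport (rotate-≅ k added) Aut[Ξ]≅A₄)
  where
    nb : ∀ {v w} → EdgeI v w → w ∈ neighbours v
    nb {v} {w} = Equivalence.to (EdgeI⇔neighbour v w)
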